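{- For every type $\sigma$, every continuation variable $\alpha$, every term $r\in\mathrm{SN}$ and every finite sequence $u_1,\dots,u_n$ ($n\ge0$) of terms in $\mathrm{SN}$, we have $(\mathtt{throw}\,\alpha\,r)\,u_1\cdots u_n\in[\![\sigma]\!]$.
   Context: Calculus $\lambda^{::}_{\mathtt{catch}}$. Types: $\sigma,\tau,\rho ::= \mathtt{unit} \mid \mathtt{list}\,\tau \mid \sigma\to\tau$. Terms: $t,r,s ::= x \mid () \mid \mathtt{nil} \mid (::) \mid \mathtt{lrec} \mid \lambda x.r \mid t\,s \mid \mathtt{catch}\,\alpha\,t \mid \mathtt{throw}\,\alpha\,t$ ($x$ variables, $\alpha,\beta$ continuation variables; application left-associative; $t::r$ abbreviates $(::)\,t\,r$). $\mathrm{FCV}$ = free continuation variables, $t[x:=r]$ capture-avoiding substitution. Values: $v,w ::= x \mid () \mid \mathtt{nil} \mid (::) \mid (::)\,v \mid (::)\,v\,w \mid \mathtt{lrec} \mid \mathtt{lrec}\,v \mid \mathtt{lrec}\,v\,w \mid \lambda x.r$. Contexts $E ::= \Box\,t \mid v\,\Box \mid \mathtt{throw}\,\alpha\,\Box$. Reduction $\to$ is the compatible closure of: $(\lambda x.t)\,v\to t[x:=v]$; $E[\mathtt{throw}\,\alpha\,t]\to\mathtt{throw}\,\alpha\,t$; $\mathtt{catch}\,\alpha\,(\mathtt{throw}\,\alpha\,t)\to\mathtt{catch}\,\alpha\,t$; $\mathtt{catch}\,\alpha\,(\mathtt{throw}\,\beta\,v)\to\mathtt{throw}\,\beta\,v$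 if $\alpha\notin\{\beta\}\cup\mathrm{FCV}(v)$; $\mathtt{catch}\,\alpha\,v\to v$ if $\alpha\notin\mathrm{FCV}(v)$; $\mathtt{lrec}\,v_r\,v_s\,\mathtt{nil}\to v_r$; $\mathtt{lrec}\,v_r\,v_s\,(v_h::v_t)\to v_s\,v_h\,v_t\,(\mathtt{lrec}\,v_r\,v_s\,v_t)$; $\twoheadrightarrow$ is its reflexive-transitive closure. $\mathrm{SN}$ is the set of terms $t$ for which the lengths of all reduction sequences starting at $t$ are bounded. For a set of terms $S$, $L(S)$ is inductively defined by: $t\in L(S)$ if for all values $v,w$ with $t\twoheadrightarrow v::w$ we have $v\in S$ and $w\in L(S)$. Interpretation: $[\![\mathtt{unit}]\!]=\mathrm{SN}$, $[\![\mathtt{list}\,\sigma]\!]=\mathrm{SN}\cap L([\![\sigma]\!])$, $[\![\sigma\to\tau]\!]=\{t\mid \forall s\in[\![\sigma]\!],\ ts\in[\![\tau]\!]\}$. -}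

module Defs where

open import Data.Nat using (ℕ; zero; suc; _≤_)
open import Data.Product using (_×_; ∃-syntax)
open import Data.List using (List; []; _∷_; foldl)
open import Relation.Binary.Construct.Closure.ReflexiveTransitive using (Star)

data Ty : Set where
  unit : Ty
  list : Ty → Ty
  _⇒_  : Ty → Ty → Ty

infixr 5 _⇒_

-- Terms (de Bruijn indices, separately for term variables and for
-- continuation variables; `lam` binds term variable 0, `catch` binds
-- continuation variable 0).

data Tm : Set where
  var   : ℕ → Tm
  unitₜ : Tm
  nil   : Tm
  cons  : Tm
  lrec  : Tm
  lam   : Tm → Tm
  app   : Tm → Tm → Tm
  catch : Tm → Tm
  throw : ℕ → Tm → Tm

_∷ₜ_ : Tm → Tm → Tm
t ∷ₜ r = app (app cons t) r

apps : Tm → List Tm → Tm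
apps = foldl app

ext : (ℕ → ℕ) → ℕ → ℕ
ext ρ zero    = zero
ext ρ (suc n) = suc (ρ n)

rename : (ℕ → ℕ) → Tm → Tm
rename ρ (var x)     = var (ρ x)
rename ρ unitₜ       = unitₜ
rename ρ nil         = nil
rename ρ cons        = cons
rename ρ lrec        = lrec
rename ρ (lam t)     = lam (rename (ext ρ) t)
rename ρ (app t s)   = app (rename ρ t) (rename ρ s)
rename ρ (catch t)   = catch (rename ρ t)
rename ρ (throw a t) = throw a (rename ρ t)

crename : (ℕ → ℕ) → Tm → Tm
crename ρ (var x)     = var x
crename ρ unitₜ       = unitₜ
crename ρ nil         = nil
crename ρ cons        = cons
crename ρ lrec        = lrec
crename ρ (lam t)     = lam (crename ρ t)
crename ρ (app t s)   = app (crename ρ t) (crename ρ s)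
crename ρ (catch t)   = catch (crename (ext ρ) t)
crename ρ (throw a t) = throw (ρ a) (crename ρ t)

exts : (ℕ → Tm) → ℕ → Tm
exts σ zero    = var zero
exts σ (suc n) = rename suc (σ n)

cexts : (ℕ → Tm) → ℕ → Tm
cexts σ n = crename suc (σ n)

subst : (ℕ → Tm) → Tm → Tm
subst σ (var x)     = σ x
subst σ unitₜ       = unitₜ
subst σ nil         = nil
subst σ cons        = cons
subst σ lrec        = lrec
subst σ (lam t)     = lam (subst (exts σ) t)
subst σ (app t s)   = app (subst σ t) (subst σ s)
subst σ (catch t)   = catch (subst (cexts σ) t)
subst σ (throw a t) = throw a (subst σ t)

single : Tm → ℕ → Tm
single v zero    = v
single v (suc n) = var n

_[_] : Tm → Tm → Tm
t [ v ] = subst (single v) t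

data Val : Tm → Set where
  v-var    : ∀ {x} → Val (var x)
  v-unit   : Val unitₜ
  v-nil    : Val nil
  v-cons0  : Val cons
  v-cons1  : ∀ {v} → Val v → Val (app cons v)
  v-cons2  : ∀ {v w} → Val v → Val w → Val (app (app cons v) w)
  v-lrec0  : Val lrec
  v-lrec1  : ∀ {v} → Val v → Val (app lrec v)
  v-lrec2  : ∀ {v w} → Val v → Val w → Val (app (app lrec v) w)
  v-lam    : ∀ {r} → Val (lam r)

-- Side condition "α ∉ FCV(v)" for the catch-binder α (index 0) is
-- expressed by requiring the term under catch to be the
-- continuation-weakening `crename suc v` of some v; the result is then v.

infix 4 _⟶_
data _⟶_ : Tm → Tm → Set where
  β        : ∀ {t v} → Val v → app (lam t) v ⟶ t [ v ]
  throwL   : ∀ {a t s} → app (throw a t) s ⟶ throw a t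
  throwR   : ∀ {a t v} → Val v → app v (throw a t) ⟶ throw a t
  throwT   : ∀ {a b t} → throw b (throw a t) ⟶ throw a t
  catchT   : ∀ {t} → catch (throw zero t) ⟶ catch t
  catchO   : ∀ {b v} → Val v → catch (throw (suc b) (crename suc v)) ⟶ throw b v
  catchV   : ∀ {v} → Val v → catch (crename suc v) ⟶ v
  lrecN    : ∀ {vr vs} → Val vr → Val vs → app (app (app lrec vr) vs) nil ⟶ vr
  lrecC    : ∀ {vr vs vh vt} → Val vr → Val vs → Val vh → Val vt →
             app (app (app lrec vr) vs) (vh ∷ₜ vt)
               ⟶ app (app (app vs vh) vt) (app (app (app lrec vr) vs) vt)
  ξ-lam    : ∀ {t t′} → t ⟶ t′ → lam t ⟶ lam t′
  ξ-appL   : ∀ {t t′ s} → t ⟶ t′ → app t s ⟶ app t′ s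
  ξ-appR   : ∀ {t s s′} → s ⟶ s′ → app t s ⟶ app t s′
  ξ-catch  : ∀ {t t′} → t ⟶ t′ → catch t ⟶ catch t′
  ξ-throw  : ∀ {a t t′} → t ⟶ t′ → throw a t ⟶ throw a t′

infix 4 _↠_
_↠_ : Tm → Tm → Set
_↠_ = Star _⟶_

data Steps : ℕ → Tm → Tm → Set where
  done : ∀ {t} → Steps zero t t
  step : ∀ {n t u w} → t ⟶ u → Steps n u w → Steps (suc n) t w

SN : Tm → Set
SN t = ∃[ k ] (∀ {n u} → Steps n t u → n ≤ k)

data L (S : Tm → Set) : Tm → Set where
  mkL : ∀ {t} →
        (∀ {v w} → Val v → Val w → t ↠ (v ∷ₜ w) → S v × L S w) →
        L S t

⟦_⟧ : Ty → Tm → Set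
⟦ unit ⟧    t = SN t
⟦ list σ ⟧  t = SN t × L ⟦ σ ⟧ t
⟦ σ ⇒ τ ⟧   t = ∀ s → ⟦ σ ⟧ s → ⟦ τ ⟧ (app t s)

-- A term (throw α r) u₁ ⋯ uₙ is never a value, so its only reductions are
-- the head throw absorbing the argument next to it, or steps inside r or
-- inside some uᵢ. Every reduct therefore has the same shape, with a smaller
-- sum of the reduction bounds of throw α r and of the uᵢ (plus one per
-- application), and no reduct is a cons cell. Such a term is thus SN and
-- vacuously in L(S). Induction on σ finishes: at an arrow type one appends
-- one more argument, which is SN because every member of ⟦ σ ⟧ is; and a
-- member t of ⟦ σ ⇒ τ ⟧ is SN since t (throw 0 ()) ∈ ⟦ τ ⟧ is.
module Submission where

open import Defs
open import Data.Nat using (ℕ)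
open import Data.List using (List)
open import Data.List.Relation.Unary.All using (All)

open import Data.Nat using (zero; suc; _+_; _≤_; _<_; z≤n; s≤s)
open import Data.Nat.Properties using (≤-refl; ≤-pred; ≤-<-trans; m≤m+n; +-monoˡ-<; +-monoʳ-<)
open import Data.List using ([]; _∷_)
open import Data.List.Relation.Unary.All using ([]; _∷_)
open import Data.Product using (_×_; _,_; proj₁; proj₂; ∃-syntax)
open import Data.Empty using (⊥-elim)
open import Relation.Nullary using (¬_)
open import Relation.Binary.PropositionalEquality using (_≡_; refl)
open import Relation.Binary.Construct.Closure.ReflexiveTransitive using (ε; _◅_)

Bounded : ℕ → Tm → Set
Bounded k t = ∀ {n u} → Steps n t u → n ≤ k

bounded-⟶ : ∀ {k t t′} → Bounded k t → t ⟶ t′ →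
            ∃[ k′ ] k ≡ suc k′ × Bounded k′ t′
bounded-⟶ {zero}  b p with b (step p done)
... | ()
bounded-⟶ {suc k} b p = k , refl , λ st → ≤-pred (b (step p st))

bounded-throw : ∀ {k a r} → Bounded k r → Bounded (suc k) (throw a r)
bounded-throw b done                    = z≤n
bounded-throw b (step throwT st)        = s≤s (b st)
bounded-throw b (step (ξ-throw p) st) with bounded-⟶ b p
... | _ , refl , b′ = s≤s (bounded-throw b′ st)

SN-appˡ : ∀ {t s} → SN (app t s) → SN t
SN-appˡ (k , b) = k , λ st → b (steps-appˡ st)
  where
  steps-appˡ : ∀ {n t u s} → Steps n t u → Steps n (app t s) (app u s)
  steps-appˡ done        = done
  steps-appˡ (step p st) = step (ξ-appL p) (steps-appˡ st)

SN-unit : SN unitₜ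
SN-unit = 0 , λ { done → z≤n ; (step () _) }

data ThrowSpine : ℕ → Tm → Set where
  head : ∀ {k a r} → Bounded k (throw a r) → ThrowSpine k (throw a r)
  _·_  : ∀ {m k t s} → ThrowSpine m t → Bounded k s →
         ThrowSpine (suc (m + k)) (app t s)

throwSpine-¬Val : ∀ {m t} → ThrowSpine m t → ¬ Val t
throwSpine-¬Val (() · _)       (v-cons1 _)
throwSpine-¬Val ((() · _) · _) (v-cons2 _ _)
throwSpine-¬Val (() · _)       (v-lrec1 _)
throwSpine-¬Val ((() · _) · _) (v-lrec2 _ _)

throwSpine-¬cons : ∀ {m v w} → ¬ ThrowSpine m (v ∷ₜ w)
throwSpine-¬cons ((() · _) · _)

throwSpine-⟶ : ∀ {m t t′} → ThrowSpine m t → t ⟶ t′ →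
               ∃[ m′ ] m′ < m × ThrowSpine m′ t′
throwSpine-⟶ (head b) p with bounded-⟶ b p
throwSpine-⟶ (head b) throwT      | k′ , refl , b′ = k′ , ≤-refl , head b′
throwSpine-⟶ (head b) (ξ-throw _) | k′ , refl , b′ = k′ , ≤-refl , head b′
throwSpine-⟶ (() · _) (β _)
throwSpine-⟶ (_·_ {m} {k} sp _) throwL = m , s≤s (m≤m+n m k) , sp
throwSpine-⟶ (sp · _) (throwR v)        with () ← throwSpine-¬Val sp v
throwSpine-⟶ (sp · _) (lrecN vr vs)     with () ← throwSpine-¬Val sp (v-lrec2 vr vs)
throwSpine-⟶ (sp · _) (lrecC vr vs _ _) with () ← throwSpine-¬Val sp (v-lrec2 vr vs)
throwSpine-⟶ (_·_ {k = k} sp b) (ξ-appL p) with throwSpine-⟶ sp p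
... | m′ , m′<m , sp′ = suc (m′ + k) , s≤s (+-monoˡ-< k m′<m) , sp′ · b
throwSpine-⟶ (_·_ {m} sp b) (ξ-appR p) with bounded-⟶ b p
... | k′ , refl , b′ = suc (m + k′) , s≤s (+-monoʳ-< m ≤-refl) , sp · b′

throwSpine-bounded : ∀ {m t} → ThrowSpine m t → Bounded m t
throwSpine-bounded sp done = z≤n
throwSpine-bounded sp (step p st) with throwSpine-⟶ sp p
... | _ , m′<m , sp′ = ≤-<-trans (throwSpine-bounded sp′ st) m′<m

throwSpine-↠ : ∀ {m t u} → ThrowSpine m t → t ↠ u → ∃[ m′ ] ThrowSpine m′ u
throwSpine-↠ sp ε       = _ , sp
throwSpine-↠ sp (p ◅ r) with throwSpine-⟶ sp p
... | _ , _ , sp′ = throwSpine-↠ sp′ r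

throwSpine-SN : ∀ {m t} → ThrowSpine m t → SN t
throwSpine-SN sp = _ , throwSpine-bounded sp

throwSpine-L : ∀ {m t} S → ThrowSpine m t → L S t
throwSpine-L S sp = mkL λ _ _ t↠v∷w → let _ , sp′ = throwSpine-↠ sp t↠v∷w
                                      in ⊥-elim (throwSpine-¬cons sp′)

throwSpine-throw : ∀ {a r} → SN r → ∃[ m ] ThrowSpine m (throw a r)
throwSpine-throw (k , b) = suc k , head (bounded-throw b)

throwSpine-apps : ∀ {m t} → ThrowSpine m t → (us : List Tm) → All SN us →
                  ∃[ m′ ] ThrowSpine m′ (apps t us)
throwSpine-apps sp []       []             = _ , sp
throwSpine-apps sp (u ∷ us) ((_ , b) ∷ bs) = throwSpine-apps (sp · b) us bs

mutual
  ⟦⟧⇒SN : ∀ σ {t} → ⟦ σ ⟧ t → SN t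
  ⟦⟧⇒SN unit     t∈ = t∈
  ⟦⟧⇒SN (list σ) t∈ = proj₁ t∈
  ⟦⟧⇒SN (σ ⇒ τ)  t∈ = SN-appˡ (⟦⟧⇒SN τ (t∈ _ (throwSpine-⟦⟧ σ stuck)))
    where
    stuck : ThrowSpine 1 (throw 0 unitₜ)
    stuck = proj₂ (throwSpine-throw SN-unit)

  throwSpine-⟦⟧ : ∀ σ {m t} → ThrowSpine m t → ⟦ σ ⟧ t
  throwSpine-⟦⟧ unit     sp        = throwSpine-SN sp
  throwSpine-⟦⟧ (list σ) sp        = throwSpine-SN sp , throwSpine-L ⟦ σ ⟧ sp
  throwSpine-⟦⟧ (σ ⇒ τ)  sp s s∈ = let _ , b = ⟦⟧⇒SN σ s∈ in throwSpine-⟦⟧ τ (sp · b)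

corollary4p10 : (σ : Ty) (α : ℕ) (r : Tm) → SN r →
                (us : List Tm) → All SN us →
                ⟦ σ ⟧ (apps (throw α r) us)
corollary4p10 σ α r r∈SN us us∈SN =
  let _ , sp = throwSpine-throw r∈SN
      _ , sp′ = throwSpine-apps sp us us∈SN
  in throwSpine-⟦⟧ σ sp′
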